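{- Let $q$ be a positive integer and $B_q=(S(m,n;q))_{m,n=1}^q$. Then for every positive integer $j$, \[ \mathrm{tr}(B_q^{2j})=q^{2j}\varphi(q),\qquad \mathrm{tr}(B_q^{2j-1})=q^{2j-1}\widetilde{\varphi}(q). \]
   Context: For integers $m,n$, the Kloosterman sum is $S(m,n;q)=\sum_{1\le k\le q,\ \gcd(k,q)=1}\exp\bigl(\frac{2\pi i}{q}(mk+nk^*)\bigr)$, where $k^*$ denotes an inverse of $k$ modulo $q$. $\varphi$ is Euler's totient function, $\widetilde{\varphi}(q)=\#\{1\le k\le q:\ \gcd(k,q)=1,\ k+k^*\equiv 0\pmod q\}$, and $\mathrm{tr}$ denotes the trace. -}

module Defs where

open import Level using (Level)
open import Data.Nat using (ℕ; zero; suc; _%_; _≟_; NonZero)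
open import Data.Nat as ℕ using ()
open import Data.Nat.GCD using (gcd)
open import Data.List using (List; []; _∷_; foldr; map; filter; length)
open import Data.Bool using (Bool; true; false; if_then_else_)
open import Relation.Nullary.Decidable using (does; ⌊_⌋)
open import Algebra.Bundles using (CommutativeRing)
open import Data.Product using () renaming (_×_ to _×ₚ_)
open import Relation.Binary.PropositionalEquality using (_≡_)
open import Relation.Nullary using (¬_)

range1 : ℕ → List ℕ
range1 zero = []
range1 (suc q) = go (suc q) 1
  where
  go : ℕ → ℕ → List ℕ
  go zero _ = []
  go (suc r) i = i ∷ go r (suc i)

_≡[_]ᵇ_ : ℕ → (q : ℕ) → .{{NonZero q}} → ℕ → Bool
a ≡[ q ]ᵇ b = ⌊ (a % q) ≟ (b % q) ⌋

-- k* : an inverse of k modulo q (the least k' in [1..q] with k k' ≡ 1 mod q;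
-- only used for k coprime to q, where it exists)
inv : (q : ℕ) → .{{NonZero q}} → ℕ → ℕ
inv q k = search (range1 q)
  where
  search : List ℕ → ℕ
  search [] = 0
  search (x ∷ xs) = if (k ℕ.* x) ≡[ q ]ᵇ 1 then x else search xs

coprimeᵇ : ℕ → ℕ → Bool
coprimeᵇ k q = ⌊ gcd k q ≟ 1 ⌋

units : (q : ℕ) → List ℕ
units q = filter (λ k → gcd k q ≟ 1) (range1 q)

φ : ℕ → ℕ
φ q = length (units q)

φ̃ : (q : ℕ) → .{{NonZero q}} → ℕ
φ̃ q = length (filter (λ k → ((k ℕ.+ inv q k) % q) ≟ 0) (units q))

-- Everything below is over a commutative ring R with an element ζ playing
-- the role of exp(2πi/q).
module Kloosterman {c ℓ : Level} (R : CommutativeRing c ℓ) where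
  open CommutativeRing R

  infixr 8 _^_
  _^_ : Carrier → ℕ → Carrier
  x ^ zero = 1#
  x ^ suc n = x * (x ^ n)

  Σ : List ℕ → (ℕ → Carrier) → Carrier
  Σ xs f = foldr (λ x acc → f x + acc) 0# xs

  fromℕ : ℕ → Carrier
  fromℕ zero = 0#
  fromℕ (suc n) = 1# + fromℕ n

  -- ζ is a primitive q-th root of unity in the sense of the orthogonality
  -- relations: ζ^q = 1 and Σ_{k=1}^{q} ζ^{a k} = 0 whenever q ∤ a.
  -- (In ℂ, ζ = exp(2πi/q) satisfies this.)
  IsPrimRoot : (q : ℕ) → .{{NonZero q}} → Carrier → Set ℓ
  IsPrimRoot q ζ = (ζ ^ q ≈ 1#) ×ₚ (∀ a → ¬ (a % q ≡ 0) → Σ (range1 q) (λ k → ζ ^ (a ℕ.* k)) ≈ 0#)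

  S : (ζ : Carrier) → ℕ → ℕ → (q : ℕ) → .{{NonZero q}} → Carrier
  S ζ m n q = Σ (units q) (λ k → ζ ^ (m ℕ.* k ℕ.+ n ℕ.* inv q k))

  -- q×q matrices indexed by 1..q, represented as functions
  Mat : Set c
  Mat = ℕ → ℕ → Carrier

  mul : ℕ → Mat → Mat → Mat
  mul q A B m n = Σ (range1 q) (λ l → A m l * B l n)

  identity : Mat
  identity m n = if ⌊ m ≟ n ⌋ then 1# else 0#

  pow : ℕ → Mat → ℕ → Mat
  pow q A zero = identity
  pow q A (suc N) = mul q A (pow q A N)

  tr : ℕ → Mat → Carrier
  tr q A = Σ (range1 q) (λ m → A m m)

  B : (ζ : Carrier) → (q : ℕ) → .{{NonZero q}} → Mat
  B ζ q m n = S ζ m n q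

{-# OPTIONS --safe #-}
module Submission where

open import Defs
open import Level using (Level)
open import Algebra.Bundles using (CommutativeRing)
open import Data.Nat as ℕ using (ℕ; zero; suc; NonZero)
open import Data.Bool using (Bool; true; false; if_then_else_)
open import Data.List using (List; []; _∷_)
open import Relation.Binary.PropositionalEquality as ≡ using (_≡_)

-- Write e(a) = ζ^a and, for T : ℕ → ℕ, K_T(m,n) = Σ_{k unit} e(mk + n T(k)), so that B = K_{(·)*}.
-- In (B K_T)(m,n) the inner sum Σ_{l=1}^q e(l(k* + k′)) vanishes unless k′ ≡ -k* (orthogonality),
-- whence B K_T = q K_{T′} with T′(k) ≡ T(-k*). Starting from T = (·)* this alternates between
-- T = -id and T = (·)*, so B^(2i+1) = q^(2i) K_{(·)*} and B^(2i+2) = q^(2i+1) K_{-id}. Finally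
-- tr K_T = Σ_k Σ_m e(m(k + T(k))) = q · #{k unit : k + T(k) ≡ 0}, which is q φ̃(q) for T = (·)*
-- and q φ(q) for T = -id.

module Range1 where

  open import Data.Nat using (_+_)
  open import Data.Nat.Properties using (+-identityʳ; +-suc; <⇒≢; suc-injective)
  open import Data.List using (applyUpTo; upTo; length)
  open import Data.List.Properties using (length-applyUpTo; map-upTo; map-cong)
  open import Data.List.Relation.Unary.Unique.Propositional using (Unique)
  open import Data.List.Relation.Unary.Unique.Propositional.Properties using (applyUpTo⁺₁)
  open import Function using (_$_)
  open import Relation.Binary.PropositionalEquality

  counting-up : (G : ℕ → ℕ → ℕ → List ℕ) →
                (∀ h i → G h 0 i ≡ []) → (∀ h r i → G h (suc r) i ≡ i ∷ G h r (suc i)) →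
                ∀ h r i → G h r i ≡ applyUpTo (i +_) r
  counting-up G G-zero G-suc h zero i = G-zero h i
  counting-up G G-zero G-suc h (suc r) i = begin
    G h (suc r) i                ≡⟨ G-suc h r i ⟩
    i ∷ G h r (suc i)            ≡⟨ cong (i ∷_) (counting-up G G-zero G-suc h r (suc i)) ⟩
    i ∷ applyUpTo (suc i +_) r   ≡⟨ cong₂ _∷_ (sym (+-identityʳ i)) (applyUpTo-cong (λ n → sym (+-suc i n)) r) ⟩
    applyUpTo (i +_) (suc r)     ∎
    where
    open ≡-Reasoning
    applyUpTo-cong : ∀ {f g : ℕ → ℕ} → (∀ n → f n ≡ g n) → ∀ r → applyUpTo f r ≡ applyUpTo g r
    applyUpTo-cong {f} {g} f≗g r = trans (sym (map-upTo f r)) (trans (map-cong f≗g (upTo r)) (map-upTo g r))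

  -- Defs builds range1 and inv from local helper functions, which cannot be named here; abstracting
  -- their arguments with 'with' exposes them as patterns, so unification instantiates the generic lemmas.
  range1≡applyUpTo : ∀ q → range1 q ≡ applyUpTo suc q
  range1≡applyUpTo zero = refl
  range1≡applyUpTo (suc zero) = refl
  range1≡applyUpTo (suc (suc q))
    with counting-up _ (λ _ _ → refl) (λ _ _ _ → refl) | q | 3 in i≡3 | suc q
  ... | go≡ | r | i | h = cong (λ xs → 1 ∷ 2 ∷ xs) (trans (go≡ h r i) (cong (λ j → applyUpTo (j +_) r) (sym i≡3)))

  range1-unique : ∀ q → Unique (range1 q)
  range1-unique q = subst Unique (sym (range1≡applyUpTo q)) $
    applyUpTo⁺₁ suc q (λ i<j _ i+1≡j+1 → <⇒≢ i<j (suc-injective i+1≡j+1))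

  length-range1 : ∀ q → length (range1 q) ≡ q
  length-range1 q = trans (cong length (range1≡applyUpTo q)) (length-applyUpTo suc q)

open Range1

module LinearSearch (t : ℕ → Bool) where

  open import Data.List.Relation.Unary.All using (All; []; _∷_)

  data SearchResult (xs : List ℕ) (r : ℕ) : Set where
    hit  : t r ≡ true → SearchResult xs r
    miss : All (λ x → t x ≡ false) xs → SearchResult xs r

  linear-search : (F : List ℕ → ℕ) → (∀ x xs → F (x ∷ xs) ≡ (if t x then x else F xs)) →
                  ∀ xs → SearchResult xs (F xs)
  linear-search F F-∷ [] = miss []
  linear-search F F-∷ (x ∷ xs) rewrite F-∷ x xs with t x in tx
  ... | true = hit tx
  ... | false with linear-search F F-∷ xs
  ...   | hit found = hit found
  ...   | miss none = miss (tx ∷ none)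

open LinearSearch using (SearchResult; hit; miss; linear-search)

-- As for range1, abstracting range1 q exposes the local search function of inv as a pattern.
inv-search : ∀ q .{{_ : NonZero q}} k → SearchResult (λ x → (k ℕ.* x) ≡[ q ]ᵇ 1) (range1 q) (inv q k)
inv-search q k with range1 q | linear-search (λ x → (k ℕ.* x) ≡[ q ]ᵇ 1) _ (λ _ _ → ≡.refl)
... | xs | search = search xs

module Modulo (q : ℕ) .{{_ : NonZero q}} where

  open import Data.Nat
  open import Data.Nat.Properties
  open import Data.Nat.DivMod
  open import Data.Nat.Divisibility
  open import Data.Nat.GCD using (gcd; module Bézout)
  open import Data.Nat.Coprimality using (Coprime; coprime-Bézout; gcd≡1⇒coprime; coprime⇒gcd≡1)
  open import Data.Nat.Tactic.RingSolver using (solve-∀)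
  open import Data.Bool.Properties using (T-≡)
  open import Data.List.Membership.Propositional using (_∈_)
  open import Data.List.Membership.Propositional.Properties using (∈-applyUpTo⁺; ∈-applyUpTo⁻; ∈-filter⁺; ∈-filter⁻)
  open import Data.List.Relation.Unary.All as All using ()
  open import Data.List.Relation.Unary.Unique.Propositional using (Unique)
  open import Data.List.Relation.Unary.Unique.Propositional.Properties using (filter⁺)
  open import Data.Product using (Σ-syntax; _×_; _,_; proj₂; map₂)
  open import Function.Bundles using (module Equivalence)
  open import Relation.Binary.Bundles using (Setoid)
  import Relation.Binary.Reasoning.Setoid
  open import Relation.Binary.PropositionalEquality
  open import Relation.Nullary using (contradiction)
  open import Relation.Nullary.Decidable using (toWitness; fromWitness)
  open import Algebra.Properties.CommutativeSemigroup *-commutativeSemigroup using (x∙yz≈y∙xz)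

  p : ℕ
  p = pred q

  1+p≡q : suc p ≡ q
  1+p≡q = suc-pred q

  -- A record rather than an equation of remainders, so that a and b are inferable from a proof.
  infix 4 _≡ₘ_
  record _≡ₘ_ (a b : ℕ) : Set where
    constructor ≡ₘ-intro
    field %-≡ : a % q ≡ b % q
  open _≡ₘ_ public

  ≡ₘ-setoid : Setoid _ _
  ≡ₘ-setoid = record
    { Carrier = ℕ
    ; _≈_ = _≡ₘ_
    ; isEquivalence = record
      { refl = ≡ₘ-intro refl
      ; sym = λ a≡b → ≡ₘ-intro (sym (%-≡ a≡b))
      ; trans = λ a≡b b≡c → ≡ₘ-intro (trans (%-≡ a≡b) (%-≡ b≡c)) } }

  open Setoid ≡ₘ-setoid public using () renaming (refl to ≡ₘ-refl; sym to ≡ₘ-sym; trans to ≡ₘ-trans; reflexive to ≡⇒≡ₘ)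

  +-congₘ : ∀ {a b c d} → a ≡ₘ b → c ≡ₘ d → a + c ≡ₘ b + d
  +-congₘ {a} {b} {c} {d} a≡b c≡d = ≡ₘ-intro (begin
    (a + c) % q               ≡⟨ %-distribˡ-+ a c q ⟩
    (a % q + c % q) % q       ≡⟨ cong₂ (λ x y → (x + y) % q) (%-≡ a≡b) (%-≡ c≡d) ⟩
    (b % q + d % q) % q       ≡⟨ %-distribˡ-+ b d q ⟨
    (b + d) % q               ∎)
    where open ≡-Reasoning

  *-congₘ : ∀ {a b c d} → a ≡ₘ b → c ≡ₘ d → a * c ≡ₘ b * d
  *-congₘ {a} {b} {c} {d} a≡b c≡d = ≡ₘ-intro (begin
    (a * c) % q               ≡⟨ %-distribˡ-* a c q ⟩
    (a % q * (c % q)) % q     ≡⟨ cong₂ (λ x y → (x * y) % q) (%-≡ a≡b) (%-≡ c≡d) ⟩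
    (b % q * (d % q)) % q     ≡⟨ %-distribˡ-* b d q ⟨
    (b * d) % q               ∎)
    where open ≡-Reasoning

  q*≡ₘ0 : ∀ a → q * a ≡ₘ 0
  q*≡ₘ0 a = ≡ₘ-intro (trans (cong (_% q) (*-comm q a)) (trans (m*n%n≡0 a q) (sym (m*n%n≡0 0 q))))

  %≡0⇒≡ₘ0 : ∀ {a} → a % q ≡ 0 → a ≡ₘ 0
  %≡0⇒≡ₘ0 a%q≡0 = ≡ₘ-intro (trans a%q≡0 (sym (m*n%n≡0 0 q)))

  ≡ₘ0⇒%≡0 : ∀ {a} → a ≡ₘ 0 → a % q ≡ 0
  ≡ₘ0⇒%≡0 a≡0 = trans (%-≡ a≡0) (m*n%n≡0 0 q)

  module ≡ₘ-Reasoning = Relation.Binary.Reasoning.Setoid ≡ₘ-setoid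

  -- p = q - 1 represents -1 modulo q.
  +p*≡ₘ0 : ∀ a → a + p * a ≡ₘ 0
  +p*≡ₘ0 a = ≡ₘ-trans (≡⇒≡ₘ (cong (_* a) 1+p≡q)) (q*≡ₘ0 a)

  +-cancelˡₘ : ∀ a {b c} → a + b ≡ₘ a + c → b ≡ₘ c
  +-cancelˡₘ a {b} {c} a+b≡a+c = begin
    b                   ≈⟨ +-congₘ (+p*≡ₘ0 a) ≡ₘ-refl ⟨
    a + p * a + b       ≡⟨ shuffle b ⟩
    p * a + (a + b)     ≈⟨ +-congₘ (≡ₘ-refl {p * a}) a+b≡a+c ⟩
    p * a + (a + c)     ≡⟨ shuffle c ⟨
    a + p * a + c       ≈⟨ +-congₘ (+p*≡ₘ0 a) ≡ₘ-refl ⟩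
    c                   ∎
    where
    open ≡ₘ-Reasoning
    shuffle : ∀ x → a + p * a + x ≡ p * a + (a + x)
    shuffle x = trans (cong (_+ x) (+-comm a (p * a))) (+-assoc (p * a) a x)

  +≡ₘ0⇒≡ₘp* : ∀ {a b} → a + b ≡ₘ 0 → b ≡ₘ p * a
  +≡ₘ0⇒≡ₘp* {a} {b} a+b≡0 = +-cancelˡₘ a (≡ₘ-trans a+b≡0 (≡ₘ-sym (+p*≡ₘ0 a)))

  p*p≡ₘ1 : p * p ≡ₘ 1
  p*p≡ₘ1 = ≡ₘ-sym (+≡ₘ0⇒≡ₘp* (begin
    p + 1     ≡⟨ cong (_+ 1) (*-identityʳ p) ⟨
    p * 1 + 1 ≡⟨ +-comm (p * 1) 1 ⟩
    1 + p * 1 ≈⟨ +p*≡ₘ0 1 ⟩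
    0         ∎))
    where open ≡ₘ-Reasoning

  *-inverse-unique : ∀ {a b c} → a * b ≡ₘ 1 → a * c ≡ₘ 1 → b ≡ₘ c
  *-inverse-unique {a} {b} {c} ab≡1 ac≡1 = begin
    b             ≡⟨ *-identityʳ b ⟨
    b * 1         ≈⟨ *-congₘ (≡ₘ-refl {b}) ac≡1 ⟨
    b * (a * c)   ≡⟨ x∙yz≈y∙xz b a c ⟩
    a * (b * c)   ≡⟨ *-assoc a b c ⟨
    a * b * c     ≈⟨ *-congₘ ab≡1 ≡ₘ-refl ⟩
    1 * c         ≡⟨ *-identityˡ c ⟩
    c             ∎
    where
    open ≡ₘ-Reasoning

  invertible⇒coprime : ∀ {a b} → a * b ≡ₘ 1 → Coprime a q
  invertible⇒coprime {a} {b} ab≡1 (d∣a , d∣q) =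
    ∣1⇒≡1 (∣n∣m%n⇒∣m {m = 1} d∣q (subst (_ ∣_) (%-≡ ab≡1) (%-presˡ-∣ {m = a * b} (∣m⇒∣m*n b d∣a) d∣q)))

  coprime⇒invertible : ∀ {k} → Coprime k q → Σ[ w ∈ ℕ ] k * w ≡ₘ 1
  coprime⇒invertible {k} k⊥q with coprime-Bézout k⊥q
  ... | Bézout.+- x y 1+yq≡xk = x , (begin
    k * x         ≡⟨ trans (*-comm k x) (sym 1+yq≡xk) ⟩
    1 + y * q     ≈⟨ ≡ₘ-intro ([m+kn]%n≡m%n 1 y q) ⟩
    1             ∎)
    where open ≡ₘ-Reasoning
  ... | Bézout.-+ x y 1+xk≡yq = p * x , (begin
    k * (p * x)     ≡⟨ x∙yz≈y∙xz k p x ⟩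
    p * (k * x)     ≡⟨ cong (p *_) (*-comm k x) ⟩
    p * (x * k)     ≈⟨ +≡ₘ0⇒≡ₘp* (x*k+1≡ₘ0) ⟨
    1               ∎)
    where
    open ≡ₘ-Reasoning
    x*k+1≡ₘ0 : x * k + 1 ≡ₘ 0
    x*k+1≡ₘ0 = ≡ₘ-trans (≡⇒≡ₘ (trans (+-comm (x * k) 1) (trans 1+xk≡yq (*-comm y q)))) (q*≡ₘ0 y)

  range1-representative : ∀ a → Σ[ r ∈ ℕ ] r ∈ range1 q × r ≡ₘ a
  range1-representative a = suc ((a + p) % q) , r∈range1 , (begin
    1 + (a + p) % q     ≈⟨ +-congₘ (≡ₘ-refl {1}) (≡ₘ-intro (m%n%n≡m%n (a + p) q)) ⟩
    1 + (a + p)         ≡⟨ +-suc a p ⟨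
    a + suc p           ≡⟨ cong (a +_) 1+p≡q ⟩
    a + q               ≈⟨ ≡ₘ-intro ([m+n]%n≡m%n a q) ⟩
    a                   ∎)
    where
    open ≡ₘ-Reasoning
    r∈range1 : suc ((a + p) % q) ∈ range1 q
    r∈range1 = subst (suc ((a + p) % q) ∈_) (sym (range1≡applyUpTo q)) (∈-applyUpTo⁺ suc (m%n<n (a + p) q))

  range1-≡ₘ⇒≡ : ∀ {x y} → x ∈ range1 q → y ∈ range1 q → x ≡ₘ y → x ≡ y
  range1-≡ₘ⇒≡ {x} {y} x∈ y∈ x≡y
    with i , i<q , refl ← ∈-applyUpTo⁻ suc (subst (x ∈_) (range1≡applyUpTo q) x∈)
       | j , j<q , refl ← ∈-applyUpTo⁻ suc (subst (y ∈_) (range1≡applyUpTo q) y∈) =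
    cong suc (begin
      i         ≡⟨ m<n⇒m%n≡m i<q ⟨
      i % q     ≡⟨ %-≡ (+-cancelˡₘ 1 x≡y) ⟩
      j % q     ≡⟨ m<n⇒m%n≡m j<q ⟩
      j         ∎)
    where open ≡-Reasoning

  coprime⇒range1-inverse : ∀ {k} → Coprime k q → Σ[ r ∈ ℕ ] r ∈ range1 q × k * r ≡ₘ 1
  coprime⇒range1-inverse {k} k⊥q with w , kw≡1 ← coprime⇒invertible k⊥q
    with r , r∈ , r≡w ← range1-representative w = r , r∈ , ≡ₘ-trans (*-congₘ (≡ₘ-refl {k}) r≡w) kw≡1

  inv-inverse : ∀ {k} → Coprime k q → k * inv q k ≡ₘ 1
  inv-inverse {k} k⊥q with inv-search q k
  ... | hit found = ≡ₘ-intro (toWitness (Equivalence.from T-≡ found))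
  ... | miss none with r , r∈ , kr≡1 ← coprime⇒range1-inverse k⊥q =
    contradiction (trans (sym (Equivalence.to T-≡ (fromWitness (%-≡ kr≡1)))) (All.lookup none r∈)) λ ()

  U : List ℕ
  U = units q

  U-unique : Unique U
  U-unique = filter⁺ (λ k → gcd k q ≟ 1) (range1-unique q)

  ∈U⁻ : ∀ {k} → k ∈ U → k ∈ range1 q × Coprime k q
  ∈U⁻ k∈U = map₂ gcd≡1⇒coprime (∈-filter⁻ (λ k → gcd k q ≟ 1) k∈U)

  ∈U⁺ : ∀ {k} → k ∈ range1 q → Coprime k q → k ∈ U
  ∈U⁺ k∈ k⊥q = ∈-filter⁺ (λ k → gcd k q ≟ 1) k∈ (coprime⇒gcd≡1 k⊥q)

  neg-inv-*-neg : ∀ {k u} → Coprime k q → u ≡ₘ p * inv q k → u * (p * k) ≡ₘ 1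
  neg-inv-*-neg {k} {u} k⊥q u≡-k* = begin
    u * (p * k)                 ≈⟨ *-congₘ u≡-k* (≡ₘ-refl {p * k}) ⟩
    p * inv q k * (p * k)       ≡⟨ rearrange p (inv q k) k ⟩
    p * p * (k * inv q k)       ≈⟨ *-congₘ p*p≡ₘ1 (inv-inverse k⊥q) ⟩
    1                           ∎
    where
    open ≡ₘ-Reasoning
    rearrange : ∀ p i k → p * i * (p * k) ≡ p * p * (k * i)
    rearrange = solve-∀

  neg-inv-unique : ∀ k {x u} → x ∈ range1 q → u ∈ range1 q → inv q k + x ≡ₘ 0 → inv q k + u ≡ₘ 0 → x ≡ u
  neg-inv-unique k x∈ u∈ k*+x≡0 k*+u≡0 =
    range1-≡ₘ⇒≡ x∈ u∈ (≡ₘ-trans (+≡ₘ0⇒≡ₘp* k*+x≡0) (≡ₘ-sym (+≡ₘ0⇒≡ₘp* k*+u≡0)))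

  neg-inv-unit : ∀ {k} → k ∈ U → Σ[ u ∈ ℕ ] u ∈ U × inv q k + u ≡ₘ 0
  neg-inv-unit {k} k∈U with u , u∈ , u≡-k* ← range1-representative (p * inv q k) =
    u , ∈U⁺ u∈ (invertible⇒coprime (neg-inv-*-neg (proj₂ (∈U⁻ k∈U)) u≡-k*)) , (begin
      inv q k + u               ≈⟨ +-congₘ (≡ₘ-refl {inv q k}) u≡-k* ⟩
      inv q k + p * inv q k     ≈⟨ +p*≡ₘ0 (inv q k) ⟩
      0                         ∎)
    where open ≡ₘ-Reasoning

  inv-neg-inv : ∀ {k u} → k ∈ U → u ∈ U → inv q k + u ≡ₘ 0 → inv q u ≡ₘ p * k
  inv-neg-inv {u = u} k∈U u∈U k*+u≡0 = *-inverse-unique {u} (inv-inverse (proj₂ (∈U⁻ u∈U)))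
    (neg-inv-*-neg (proj₂ (∈U⁻ k∈U)) (+≡ₘ0⇒≡ₘp* k*+u≡0))

  neg-neg-inv : ∀ {k u} → inv q k + u ≡ₘ 0 → p * u ≡ₘ inv q k
  neg-neg-inv {k} {u} k*+u≡0 = begin
    p * u               ≈⟨ *-congₘ (≡ₘ-refl {p}) (+≡ₘ0⇒≡ₘp* k*+u≡0) ⟩
    p * (p * inv q k)   ≡⟨ *-assoc p p (inv q k) ⟨
    p * p * inv q k     ≈⟨ *-congₘ p*p≡ₘ1 ≡ₘ-refl ⟩
    1 * inv q k         ≡⟨ *-identityˡ (inv q k) ⟩
    inv q k             ∎
    where open ≡ₘ-Reasoning

module RingLemmas {c ℓ : Level} (R : CommutativeRing c ℓ) where

  open import Data.Nat using (_≟_)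
  open import Data.List using (length; filter)
  open import Data.List.Properties using (filter-none)
  open import Data.List.Membership.Propositional using (_∈_)
  open import Data.List.Relation.Unary.Any using (here; there)
  open import Data.List.Relation.Unary.All as All using (All)
  open import Data.List.Relation.Unary.AllPairs using (_∷_)
  open import Data.List.Relation.Unary.Unique.Propositional using (Unique)
  open import Function using (_∘_)
  open import Relation.Nullary using (¬_; yes; no; does; contradiction)
  open import Relation.Nullary.Decidable using (⌊_⌋; isYes≗does)
  open import Relation.Unary using (Pred; Decidable)

  open CommutativeRing R
  open Kloosterman R using (Σ; fromℕ; _^_; Mat; mul; identity)
  import Algebra.Properties.Semiring.Exp semiring as Exp
  open import Relation.Binary.Reasoning.Setoid setoid
  open import Algebra.Properties.CommutativeSemigroup +-commutativeSemigroup using (interchange)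
  import Algebra.Properties.Semiring.Mult semiring as Mult

  Σ-cong : ∀ xs {f g : ℕ → Carrier} → (∀ {x} → x ∈ xs → f x ≈ g x) → Σ xs f ≈ Σ xs g
  Σ-cong [] f≈g = refl
  Σ-cong (x ∷ xs) f≈g = +-cong (f≈g (here ≡.refl)) (Σ-cong xs (f≈g ∘ there))

  Σ-cong′ : ∀ xs {f g : ℕ → Carrier} → (∀ x → f x ≈ g x) → Σ xs f ≈ Σ xs g
  Σ-cong′ xs f≈g = Σ-cong xs (λ {x} _ → f≈g x)

  Σ-zero : ∀ xs → Σ xs (λ _ → 0#) ≈ 0#
  Σ-zero [] = refl
  Σ-zero (x ∷ xs) = trans (+-identityˡ _) (Σ-zero xs)

  Σ-+ : ∀ xs (f g : ℕ → Carrier) → Σ xs (λ x → f x + g x) ≈ Σ xs f + Σ xs g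
  Σ-+ [] f g = sym (+-identityʳ 0#)
  Σ-+ (x ∷ xs) f g = trans (+-cong refl (Σ-+ xs f g)) (interchange (f x) (g x) (Σ xs f) (Σ xs g))

  *-distribˡ-Σ : ∀ a xs (f : ℕ → Carrier) → a * Σ xs f ≈ Σ xs (λ x → a * f x)
  *-distribˡ-Σ a [] f = zeroʳ a
  *-distribˡ-Σ a (x ∷ xs) f = trans (distribˡ a (f x) (Σ xs f)) (+-cong refl (*-distribˡ-Σ a xs f))

  *-distribʳ-Σ : ∀ a xs (f : ℕ → Carrier) → Σ xs f * a ≈ Σ xs (λ x → f x * a)
  *-distribʳ-Σ a xs f = trans (*-comm _ a) (trans (*-distribˡ-Σ a xs f) (Σ-cong′ xs (λ x → *-comm a (f x))))

  Σ-comm : ∀ xs ys (f : ℕ → ℕ → Carrier) → Σ xs (λ x → Σ ys (f x)) ≈ Σ ys (λ y → Σ xs (λ x → f x y))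
  Σ-comm [] ys f = sym (Σ-zero ys)
  Σ-comm (x ∷ xs) ys f = trans (+-cong refl (Σ-comm xs ys f)) (sym (Σ-+ ys (f x) (λ y → Σ xs (λ x′ → f x′ y))))

  Σ-*-Σ-comm : ∀ zs xs ys (f g : ℕ → ℕ → Carrier) →
               Σ zs (λ z → Σ xs (f z) * Σ ys (g z)) ≈ Σ xs (λ x → Σ ys (λ y → Σ zs (λ z → f z x * g z y)))
  Σ-*-Σ-comm zs xs ys f g = begin
    Σ zs (λ z → Σ xs (f z) * Σ ys (g z))                   ≈⟨ Σ-cong′ zs (λ z → *-distribʳ-Σ _ xs (f z)) ⟩
    Σ zs (λ z → Σ xs (λ x → f z x * Σ ys (g z)))           ≈⟨ Σ-cong′ zs (λ z → Σ-cong′ xs (λ x → *-distribˡ-Σ _ ys (g z))) ⟩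
    Σ zs (λ z → Σ xs (λ x → Σ ys (λ y → f z x * g z y)))   ≈⟨ Σ-comm zs xs _ ⟩
    Σ xs (λ x → Σ zs (λ z → Σ ys (λ y → f z x * g z y)))   ≈⟨ Σ-cong′ xs (λ x → Σ-comm zs ys _) ⟩
    Σ xs (λ x → Σ ys (λ y → Σ zs (λ z → f z x * g z y)))   ∎

  fromℕ≈×1# : ∀ n → fromℕ n ≈ n Mult.× 1#
  fromℕ≈×1# zero = refl
  fromℕ≈×1# (suc n) = +-cong refl (fromℕ≈×1# n)

  fromℕ-homo-* : ∀ m n → fromℕ (m ℕ.* n) ≈ fromℕ m * fromℕ n
  fromℕ-homo-* m n = begin
    fromℕ (m ℕ.* n)             ≈⟨ fromℕ≈×1# (m ℕ.* n) ⟩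
    (m ℕ.* n) Mult.× 1#         ≈⟨ Mult.×1-homo-* m n ⟩
    m Mult.× 1# * n Mult.× 1#   ≈⟨ *-cong (fromℕ≈×1# m) (fromℕ≈×1# n) ⟨
    fromℕ m * fromℕ n           ∎

  ^≈^ : ∀ x n → x ^ n ≈ x Exp.^ n
  ^≈^ x zero = refl
  ^≈^ x (suc n) = *-cong refl (^≈^ x n)

  ^-homo-* : ∀ x m n → x ^ (m ℕ.+ n) ≈ x ^ m * x ^ n
  ^-homo-* x m n = begin
    x ^ (m ℕ.+ n)           ≈⟨ ^≈^ x (m ℕ.+ n) ⟩
    x Exp.^ (m ℕ.+ n)       ≈⟨ Exp.^-homo-* x m n ⟩
    x Exp.^ m * x Exp.^ n   ≈⟨ *-cong (^≈^ x m) (^≈^ x n) ⟨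
    x ^ m * x ^ n           ∎

  *-zero-ifʳ : ∀ x y b → x * (if b then y else 0#) ≈ (if b then x * y else 0#)
  *-zero-ifʳ x y true = refl
  *-zero-ifʳ x y false = zeroʳ x

  Σ-const : ∀ xs a → Σ xs (λ _ → a) ≈ fromℕ (length xs) * a
  Σ-const [] a = sym (zeroˡ a)
  Σ-const (x ∷ xs) a = trans (+-cong (sym (*-identityˡ a)) (Σ-const xs a)) (sym (distribʳ a 1# _))

  module _ {p} {P : Pred ℕ p} (P? : Decidable P) where

    Σ-filter : ∀ xs (f : ℕ → Carrier) → Σ (filter P? xs) f ≈ Σ xs (λ x → if does (P? x) then f x else 0#)
    Σ-filter [] f = refl
    Σ-filter (x ∷ xs) f with does (P? x)
    ... | true = +-cong refl (Σ-filter xs f)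
    ... | false = trans (Σ-filter xs f) (sym (+-identityˡ _))

    Σ-indicator-unique : ∀ {xs u} (f : ℕ → Carrier) → Unique xs → u ∈ xs → P u → (∀ {x} → x ∈ xs → P x → x ≡ u) →
                         Σ xs (λ x → if does (P? x) then f x else 0#) ≈ f u
    Σ-indicator-unique {x ∷ xs} f (x∉xs ∷ xs-unique) u∈ Pu unique with P? x
    ... | yes Px with ≡.refl ← unique (here ≡.refl) Px = begin
      f x + Σ xs (λ y → if does (P? y) then f y else 0#)   ≈⟨ +-cong refl (Σ-filter xs f) ⟨
      f x + Σ (filter P? xs) f                             ≡⟨ ≡.cong (λ ys → f x + Σ ys f) (filter-none P? ¬P-xs) ⟩
      f x + 0#                                             ≈⟨ +-identityʳ (f x) ⟩
      f x                                                  ∎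
      where
      ¬P-xs : All (λ y → ¬ P y) xs
      ¬P-xs = All.tabulate λ y∈ Py → All.lookup x∉xs y∈ (≡.sym (unique (there y∈) Py))
    Σ-indicator-unique f (_ ∷ xs-unique) (here ≡.refl) Pu unique | no ¬Px = contradiction Pu ¬Px
    Σ-indicator-unique f (_ ∷ xs-unique) (there u∈) Pu unique | no ¬Px =
      trans (+-identityˡ _) (Σ-indicator-unique f xs-unique u∈ Pu (unique ∘ there))

  mul-identityʳ : ∀ q (A : Mat) {n} → n ∈ range1 q → ∀ m → mul q A identity m n ≈ A m n
  mul-identityʳ q A {n} n∈ m = begin
    Σ (range1 q) (λ l → A m l * (if ⌊ l ≟ n ⌋ then 1# else 0#))    ≈⟨ Σ-cong′ (range1 q) entry ⟩
    Σ (range1 q) (λ l → if does (l ≟ n) then A m l * 1# else 0#)   ≈⟨ Σ-indicator-unique (_≟ n) (λ l → A m l * 1#) (range1-unique q) n∈ ≡.refl (λ _ l≡n → l≡n) ⟩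
    A m n * 1#                                                     ≈⟨ *-identityʳ (A m n) ⟩
    A m n                                                          ∎
    where
    entry : ∀ l → A m l * (if ⌊ l ≟ n ⌋ then 1# else 0#) ≈ (if does (l ≟ n) then A m l * 1# else 0#)
    entry l = trans (reflexive (≡.cong (λ b → A m l * (if b then 1# else 0#)) (isYes≗does (l ≟ n))))
                    (*-zero-ifʳ (A m l) 1# (does (l ≟ n)))

module KloostermanPowers {c ℓ : Level} (R : CommutativeRing c ℓ) (ζ : CommutativeRing.Carrier R)
                         (q : ℕ) .{{_ : NonZero q}} (ζ-primitive : Kloosterman.IsPrimRoot R q ζ) where

  open import Data.Nat using (_%_; _∸_; _≟_)
  import Data.Nat.Properties as ℕ
  open import Data.Nat.DivMod using (_/_; m≡m%n+[m/n]*n)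
  open import Data.Nat.Tactic.RingSolver using (solve-∀)
  open import Data.List using (length; filter)
  open import Data.List.Properties using (filter-all)
  open import Data.List.Membership.Propositional using (_∈_)
  open import Data.List.Relation.Unary.All as All using ()
  open import Data.Product using (_,_; proj₁; proj₂)
  open import Relation.Nullary using (Dec; yes; no; does)

  open CommutativeRing R
  open Kloosterman R using (Σ; fromℕ; _^_; Mat; mul; pow; tr; B)
  open import Algebra.Properties.CommutativeSemigroup *-commutativeSemigroup using (x∙yz≈y∙xz; x∙yz≈yx∙z)
  open import Relation.Binary.Reasoning.Setoid setoid
  open RingLemmas R
  open Modulo q

  e : ℕ → Carrier
  e a = ζ ^ a

  e-+ : ∀ a b → e (a ℕ.+ b) ≈ e a * e b
  e-+ = ^-homo-* ζ

  e-*q : ∀ c → e (c ℕ.* q) ≈ 1#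
  e-*q zero = refl
  e-*q (suc c) = trans (e-+ q (c ℕ.* q)) (trans (*-cong (proj₁ ζ-primitive) (e-*q c)) (*-identityʳ 1#))

  e-% : ∀ a → e a ≈ e (a % q)
  e-% a = begin
    e a                           ≡⟨ ≡.cong e (m≡m%n+[m/n]*n a q) ⟩
    e (a % q ℕ.+ (a / q) ℕ.* q)   ≈⟨ e-+ (a % q) _ ⟩
    e (a % q) * e ((a / q) ℕ.* q) ≈⟨ *-cong refl (e-*q (a / q)) ⟩
    e (a % q) * 1#                ≈⟨ *-identityʳ _ ⟩
    e (a % q)                     ∎

  e-cong : ∀ {a b} → a ≡ₘ b → e a ≈ e b
  e-cong {a} {b} a≡b = trans (e-% a) (trans (reflexive (≡.cong e (%-≡ a≡b))) (sym (e-% b)))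

  Σ-e-orthogonal : ∀ a → Σ (range1 q) (λ l → e (l ℕ.* a)) ≈ (if does (a % q ≟ 0) then fromℕ q else 0#)
  Σ-e-orthogonal a = by-cases (a % q ≟ 0)
    where
    by-cases : (q∣a? : Dec (a % q ≡ 0)) → Σ (range1 q) (λ l → e (l ℕ.* a)) ≈ (if does q∣a? then fromℕ q else 0#)
    by-cases (yes q∣a) = begin
      Σ (range1 q) (λ l → e (l ℕ.* a))    ≈⟨ Σ-cong′ (range1 q) (λ l → e-cong (*-congₘ (≡ₘ-refl {l}) a≡0)) ⟩
      Σ (range1 q) (λ l → e (l ℕ.* 0))    ≈⟨ Σ-cong′ (range1 q) (λ l → reflexive (≡.cong e (ℕ.*-zeroʳ l))) ⟩
      Σ (range1 q) (λ _ → 1#)             ≈⟨ Σ-const (range1 q) 1# ⟩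
      fromℕ (length (range1 q)) * 1#      ≈⟨ *-identityʳ _ ⟩
      fromℕ (length (range1 q))           ≡⟨ ≡.cong fromℕ (length-range1 q) ⟩
      fromℕ q                             ∎
      where
      a≡0 : a ≡ₘ 0
      a≡0 = %≡0⇒≡ₘ0 q∣a
    by-cases (no q∤a) = trans (Σ-cong′ (range1 q) (λ l → reflexive (≡.cong e (ℕ.*-comm l a)))) (proj₂ ζ-primitive a q∤a)

  K : (ℕ → ℕ) → Mat
  K T m n = Σ U (λ k → e (m ℕ.* k ℕ.+ n ℕ.* T k))

  -- T ⇝ T′ says T′ k ≡ T (-k*) (mod q) on units.
  infix 4 _⇝_
  _⇝_ : (ℕ → ℕ) → (ℕ → ℕ) → Set
  T ⇝ T′ = ∀ {k u} → k ∈ U → u ∈ U → inv q k ℕ.+ u ≡ₘ 0 → T u ≡ₘ T′ k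

  Σ-units-collapse : ∀ {T T′} → T ⇝ T′ → ∀ {k} → k ∈ U → ∀ c n →
    Σ U (λ k′ → e (c ℕ.+ n ℕ.* T k′) * Σ (range1 q) (λ l → e (l ℕ.* (inv q k ℕ.+ k′)))) ≈ e (c ℕ.+ n ℕ.* T′ k) * fromℕ q
  Σ-units-collapse {T} {T′} T⇝T′ {k} k∈U c n with u , u∈U , k*+u≡0 ← neg-inv-unit k∈U = begin
    Σ U (λ k′ → f k′ * Σ (range1 q) (λ l → e (l ℕ.* (inv q k ℕ.+ k′))))
      ≈⟨ Σ-cong′ U (λ k′ → *-cong refl (Σ-e-orthogonal (inv q k ℕ.+ k′))) ⟩
    Σ U (λ k′ → f k′ * (if does (P? k′) then fromℕ q else 0#))
      ≈⟨ Σ-cong′ U (λ k′ → *-zero-ifʳ (f k′) (fromℕ q) (does (P? k′))) ⟩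
    Σ U (λ k′ → if does (P? k′) then f k′ * fromℕ q else 0#)
      ≈⟨ Σ-indicator-unique P? (λ k′ → f k′ * fromℕ q) U-unique u∈U (≡ₘ0⇒%≡0 k*+u≡0) unique ⟩
    f u * fromℕ q
      ≈⟨ *-cong (e-cong (+-congₘ (≡ₘ-refl {c}) (*-congₘ (≡ₘ-refl {n}) (T⇝T′ k∈U u∈U k*+u≡0)))) refl ⟩
    e (c ℕ.+ n ℕ.* T′ k) * fromℕ q ∎
    where
    f : ℕ → Carrier
    f k′ = e (c ℕ.+ n ℕ.* T k′)
    P? : ∀ k′ → Dec ((inv q k ℕ.+ k′) % q ≡ 0)
    P? k′ = (inv q k ℕ.+ k′) % q ≟ 0
    unique : ∀ {x} → x ∈ U → (inv q k ℕ.+ x) % q ≡ 0 → x ≡ u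
    unique x∈U k*+x≡0 = neg-inv-unique k (proj₁ (∈U⁻ x∈U)) (proj₁ (∈U⁻ u∈U)) (%≡0⇒≡ₘ0 k*+x≡0) k*+u≡0

  mul-B-K : ∀ {T T′} → T ⇝ T′ → ∀ m n → mul q (B ζ q) (K T) m n ≈ fromℕ q * K T′ m n
  mul-B-K {T} {T′} T⇝T′ m n = begin
    Σ (range1 q) (λ l → Σ U (λ k → e (m ℕ.* k ℕ.+ l ℕ.* inv q k)) * Σ U (λ k′ → e (l ℕ.* k′ ℕ.+ n ℕ.* T k′)))
      ≈⟨ Σ-*-Σ-comm (range1 q) U U _ _ ⟩
    Σ U (λ k → Σ U (λ k′ → Σ (range1 q) (λ l → e (m ℕ.* k ℕ.+ l ℕ.* inv q k) * e (l ℕ.* k′ ℕ.+ n ℕ.* T k′))))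
      ≈⟨ Σ-cong′ U (λ k → Σ-cong′ U (λ k′ → regroup k k′)) ⟩
    Σ U (λ k → Σ U (λ k′ → e (m ℕ.* k ℕ.+ n ℕ.* T k′) * Σ (range1 q) (λ l → e (l ℕ.* (inv q k ℕ.+ k′)))))
      ≈⟨ Σ-cong U (λ {k} k∈U → Σ-units-collapse T⇝T′ k∈U (m ℕ.* k) n) ⟩
    Σ U (λ k → e (m ℕ.* k ℕ.+ n ℕ.* T′ k) * fromℕ q)
      ≈⟨ *-distribʳ-Σ (fromℕ q) U _ ⟨
    K T′ m n * fromℕ q
      ≈⟨ *-comm _ _ ⟩
    fromℕ q * K T′ m n ∎
    where
    exponents : ∀ m k l i k′ n t → (m ℕ.* k ℕ.+ l ℕ.* i) ℕ.+ (l ℕ.* k′ ℕ.+ n ℕ.* t)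
                                   ≡ (m ℕ.* k ℕ.+ n ℕ.* t) ℕ.+ l ℕ.* (i ℕ.+ k′)
    exponents = solve-∀
    regroup : ∀ k k′ → Σ (range1 q) (λ l → e (m ℕ.* k ℕ.+ l ℕ.* inv q k) * e (l ℕ.* k′ ℕ.+ n ℕ.* T k′))
                       ≈ e (m ℕ.* k ℕ.+ n ℕ.* T k′) * Σ (range1 q) (λ l → e (l ℕ.* (inv q k ℕ.+ k′)))
    regroup k k′ = begin
      Σ (range1 q) (λ l → e (m ℕ.* k ℕ.+ l ℕ.* inv q k) * e (l ℕ.* k′ ℕ.+ n ℕ.* T k′))
        ≈⟨ Σ-cong′ (range1 q) term ⟩
      Σ (range1 q) (λ l → e (m ℕ.* k ℕ.+ n ℕ.* T k′) * e (l ℕ.* (inv q k ℕ.+ k′)))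
        ≈⟨ *-distribˡ-Σ _ (range1 q) _ ⟨
      e (m ℕ.* k ℕ.+ n ℕ.* T k′) * Σ (range1 q) (λ l → e (l ℕ.* (inv q k ℕ.+ k′))) ∎
      where
      term : ∀ l → e (m ℕ.* k ℕ.+ l ℕ.* inv q k) * e (l ℕ.* k′ ℕ.+ n ℕ.* T k′)
                   ≈ e (m ℕ.* k ℕ.+ n ℕ.* T k′) * e (l ℕ.* (inv q k ℕ.+ k′))
      term l = begin
        e (m ℕ.* k ℕ.+ l ℕ.* inv q k) * e (l ℕ.* k′ ℕ.+ n ℕ.* T k′)       ≈⟨ e-+ (m ℕ.* k ℕ.+ l ℕ.* inv q k) _ ⟨
        e ((m ℕ.* k ℕ.+ l ℕ.* inv q k) ℕ.+ (l ℕ.* k′ ℕ.+ n ℕ.* T k′))    ≡⟨ ≡.cong e (exponents m k l (inv q k) k′ n (T k′)) ⟩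
        e ((m ℕ.* k ℕ.+ n ℕ.* T k′) ℕ.+ l ℕ.* (inv q k ℕ.+ k′))          ≈⟨ e-+ (m ℕ.* k ℕ.+ n ℕ.* T k′) _ ⟩
        e (m ℕ.* k ℕ.+ n ℕ.* T k′) * e (l ℕ.* (inv q k ℕ.+ k′))          ∎

  inv⇝neg : inv q ⇝ (p ℕ.*_)
  inv⇝neg = inv-neg-inv

  neg⇝inv : (p ℕ.*_) ⇝ inv q
  neg⇝inv _ _ = neg-neg-inv

  -- B^(N+1) = q^N K_T, on columns n ∈ [1, q] only: the identity matrix of Defs is one only there.
  PowerFormula : ℕ → (ℕ → ℕ) → Set _
  PowerFormula N T = ∀ {n} → n ∈ range1 q → ∀ m → pow q (B ζ q) (suc N) m n ≈ fromℕ (q ℕ.^ N) * K T m n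

  B-power-one : PowerFormula 0 (inv q)
  B-power-one n∈ m = trans (mul-identityʳ q (B ζ q) n∈ m) (sym (trans (*-cong (+-identityʳ 1#) refl) (*-identityˡ _)))

  B-power-step : ∀ {N T T′} → T ⇝ T′ → PowerFormula N T → PowerFormula (suc N) T′
  B-power-step {N} {T} {T′} T⇝T′ BN≈K {n} n∈ m = begin
    Σ (range1 q) (λ l → B ζ q m l * pow q (B ζ q) (suc N) l n) ≈⟨ Σ-cong (range1 q) (λ {l} _ → *-cong refl (BN≈K n∈ l)) ⟩
    Σ (range1 q) (λ l → B ζ q m l * (s * K T l n))             ≈⟨ Σ-cong′ (range1 q) (λ l → x∙yz≈y∙xz _ s _) ⟩
    Σ (range1 q) (λ l → s * (B ζ q m l * K T l n))             ≈⟨ *-distribˡ-Σ s (range1 q) _ ⟨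
    s * mul q (B ζ q) (K T) m n                                ≈⟨ *-cong refl (mul-B-K T⇝T′ m n) ⟩
    s * (fromℕ q * K T′ m n)                                   ≈⟨ x∙yz≈yx∙z s (fromℕ q) _ ⟩
    fromℕ q * s * K T′ m n                                     ≈⟨ *-cong (fromℕ-homo-* q (q ℕ.^ N)) refl ⟨
    fromℕ (q ℕ.^ suc N) * K T′ m n                             ∎
    where
    s : Carrier
    s = fromℕ (q ℕ.^ N)

  B-power-odd : ∀ i → PowerFormula (2 ℕ.* i) (inv q)
  B-power-even : ∀ i → PowerFormula (suc (2 ℕ.* i)) (p ℕ.*_)
  B-power-odd zero = B-power-one
  B-power-odd (suc i) = ≡.subst (λ N → PowerFormula N (inv q)) (≡.sym (ℕ.*-suc 2 i))
    (B-power-step {N = suc (2 ℕ.* i)} neg⇝inv (B-power-even i))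
  B-power-even i = B-power-step {N = 2 ℕ.* i} inv⇝neg (B-power-odd i)

  #anti-fixed : (ℕ → ℕ) → ℕ
  #anti-fixed T = length (filter (λ k → (k ℕ.+ T k) % q ≟ 0) U)

  tr-K : ∀ T → tr q (K T) ≈ fromℕ (q ℕ.* #anti-fixed T)
  tr-K T = begin
    Σ (range1 q) (λ m → Σ U (λ k → e (m ℕ.* k ℕ.+ m ℕ.* T k)))   ≈⟨ Σ-comm (range1 q) U _ ⟩
    Σ U (λ k → Σ (range1 q) (λ m → e (m ℕ.* k ℕ.+ m ℕ.* T k)))   ≈⟨ Σ-cong′ U (λ k → Σ-cong′ (range1 q) (factor k)) ⟩
    Σ U (λ k → Σ (range1 q) (λ m → e (m ℕ.* (k ℕ.+ T k))))       ≈⟨ Σ-cong′ U (λ k → Σ-e-orthogonal (k ℕ.+ T k)) ⟩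
    Σ U (λ k → if does ((k ℕ.+ T k) % q ≟ 0) then fromℕ q else 0#) ≈⟨ Σ-filter (λ k → (k ℕ.+ T k) % q ≟ 0) U _ ⟨
    Σ (filter (λ k → (k ℕ.+ T k) % q ≟ 0) U) (λ _ → fromℕ q)     ≈⟨ Σ-const (filter (λ k → (k ℕ.+ T k) % q ≟ 0) U) (fromℕ q) ⟩
    fromℕ (#anti-fixed T) * fromℕ q                               ≈⟨ *-comm _ _ ⟩
    fromℕ q * fromℕ (#anti-fixed T)                               ≈⟨ fromℕ-homo-* q (#anti-fixed T) ⟨
    fromℕ (q ℕ.* #anti-fixed T)                                   ∎
    where
    factor : ∀ k m → e (m ℕ.* k ℕ.+ m ℕ.* T k) ≈ e (m ℕ.* (k ℕ.+ T k))
    factor k m = reflexive (≡.cong e (≡.sym (ℕ.*-distribˡ-+ m k (T k))))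

  tr-B-power : ∀ {N M T} → N ≡ suc M → PowerFormula M T → tr q (pow q (B ζ q) N) ≈ fromℕ (q ℕ.^ N ℕ.* #anti-fixed T)
  tr-B-power {M = M} {T} ≡.refl BM≈K = begin
    Σ (range1 q) (λ m → pow q (B ζ q) (suc M) m m)    ≈⟨ Σ-cong (range1 q) (λ {m} m∈ → BM≈K m∈ m) ⟩
    Σ (range1 q) (λ m → fromℕ (q ℕ.^ M) * K T m m)    ≈⟨ *-distribˡ-Σ _ (range1 q) _ ⟨
    fromℕ (q ℕ.^ M) * tr q (K T)                      ≈⟨ *-cong refl (tr-K T) ⟩
    fromℕ (q ℕ.^ M) * fromℕ (q ℕ.* #anti-fixed T)     ≈⟨ fromℕ-homo-* (q ℕ.^ M) _ ⟨
    fromℕ (q ℕ.^ M ℕ.* (q ℕ.* #anti-fixed T))         ≡⟨ ≡.cong fromℕ (rearrange (q ℕ.^ M) q (#anti-fixed T)) ⟩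
    fromℕ (q ℕ.^ suc M ℕ.* #anti-fixed T)             ∎
    where
    rearrange : ∀ a b c → a ℕ.* (b ℕ.* c) ≡ b ℕ.* a ℕ.* c
    rearrange = solve-∀

  #anti-fixed-neg : #anti-fixed (p ℕ.*_) ≡ φ q
  #anti-fixed-neg = ≡.cong length (filter-all (λ k → (k ℕ.+ p ℕ.* k) % q ≟ 0) {U} (All.tabulate (λ {k} _ → ≡ₘ0⇒%≡0 (+p*≡ₘ0 k))))

  tr-B^even : ∀ i → tr q (pow q (B ζ q) (2 ℕ.* suc i)) ≈ fromℕ (q ℕ.^ (2 ℕ.* suc i) ℕ.* φ q)
  tr-B^even i = trans (tr-B-power (ℕ.*-suc 2 i) (B-power-even i))
    (reflexive (≡.cong (λ c → fromℕ (q ℕ.^ (2 ℕ.* suc i) ℕ.* c)) #anti-fixed-neg))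

  tr-B^odd : ∀ i → tr q (pow q (B ζ q) (2 ℕ.* suc i ∸ 1)) ≈ fromℕ (q ℕ.^ (2 ℕ.* suc i ∸ 1) ℕ.* φ̃ q)
  tr-B^odd i = tr-B-power (≡.cong (_∸ 1) (ℕ.*-suc 2 i)) (B-power-odd i)

open import Data.Nat using (_*_; _∸_; _^_)
open import Data.Product using (_×_; _,_)

lemma11 : {c ℓ : Level} (R : CommutativeRing c ℓ) (ζ : CommutativeRing.Carrier R)
          (q : ℕ) .{{_ : NonZero q}} → Kloosterman.IsPrimRoot R q ζ →
          (j : ℕ) → 1 Data.Nat.≤ j →
          (CommutativeRing._≈_ R (Kloosterman.tr R q (Kloosterman.pow R q (Kloosterman.B R ζ q) (2 * j)))
             (Kloosterman.fromℕ R (q ^ (2 * j) * φ q)))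
          × (CommutativeRing._≈_ R (Kloosterman.tr R q (Kloosterman.pow R q (Kloosterman.B R ζ q) (2 * j ∸ 1)))
             (Kloosterman.fromℕ R (q ^ (2 * j ∸ 1) * φ̃ q)))
lemma11 R ζ q ζ-primitive zero ()
lemma11 R ζ q ζ-primitive (suc i) _ = tr-B^even i , tr-B^odd i
  where open KloostermanPowers R ζ q ζ-primitive
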